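{- Let $G$ be a graph of order $n$ and let $\mathcal{F}(G)$ be the set of all forts of $G$. Then $|\mathcal{F}(G)|\leq 2^n-\mathcal{Z}(G;1)$.
   Context: A fort of a graph $G=(V,E)$ is a non-empty set $F\subseteq V$ such that no vertex outside $F$ is adjacent to exactly one vertex in $F$. Zero forcing: given a set of colored vertices, a colored vertex $u$ with exactly one uncolored neighbor $v$ may force $v$ to become colored; $S$ is a zero forcing set if starting with $S$ colored and repeatedly applying this rule colors all vertices. $z(G;i)$ is the number of zero forcing sets of size $i$ and $\mathcal{Z}(G;x)=\sum_{i=1}^n z(G;i)x^i$; thus $\mathcal{Z}(G;1)$ is the total number of zero forcing sets. -}

module Defs where

open import Data.Bool using (Bool; true; false; _∧_; _∨_; not; T)
open import Data.Nat using (ℕ; zero; suc; _+_; _≡ᵇ_)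
open import Data.Fin using (Fin)
open import Data.Fin.Subset using (Subset)
open import Data.Vec using (Vec; []; _∷_; lookup; tabulate; map)
open import Data.List using (List; []; _∷_; _++_; length; filterᵇ; allFin)
import Data.List as L
open import Relation.Binary.PropositionalEquality using (_≡_)

record Graph (n : ℕ) : Set where
  field
    adj    : Fin n → Fin n → Bool
    sym    : ∀ u v → adj u v ≡ adj v u
    irrefl : ∀ v → adj v v ≡ false
open Graph public

anyV : ∀ {n} → (Fin n → Bool) → Bool
anyV {n} p = L.foldr (λ v b → p v ∨ b) false (allFin n)

allV : ∀ {n} → (Fin n → Bool) → Bool
allV {n} p = L.foldr (λ v b → p v ∧ b) true (allFin n)

countV : ∀ {n} → (Fin n → Bool) → ℕ
countV {n} p = length (filterᵇ p (allFin n))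

_∈ᵇ_ : ∀ {n} → Fin n → Subset n → Bool
v ∈ᵇ S = lookup S v

nbrsIn : ∀ {n} → Graph n → Subset n → Fin n → ℕ
nbrsIn G F v = countV (λ u → adj G v u ∧ (u ∈ᵇ F))

isFort : ∀ {n} → Graph n → Subset n → Bool
isFort G F = anyV (λ v → v ∈ᵇ F)
           ∧ allV (λ v → (v ∈ᵇ F) ∨ not (nbrsIn G F v ≡ᵇ 1))

-- One round of the colour change rule: v becomes coloured
-- if it is already coloured, or some coloured vertex u has v as its
-- unique uncoloured neighbour.  (Applying all currently available forces
-- at once; the final coloured set does not depend on the order of forces.)
uncolouredNbrs : ∀ {n} → Graph n → Subset n → Fin n → ℕ
uncolouredNbrs G S u = countV (λ w → adj G u w ∧ not (w ∈ᵇ S))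

forceStep : ∀ {n} → Graph n → Subset n → Subset n
forceStep G S = tabulate λ v →
  (v ∈ᵇ S) ∨ anyV (λ u → (u ∈ᵇ S) ∧ adj G u v ∧ (uncolouredNbrs G S u ≡ᵇ 1))

iterate : ∀ {A : Set} → ℕ → (A → A) → A → A
iterate zero    f a = a
iterate (suc k) f a = iterate k f (f a)

-- The final coloured set (closure) of S: after n rounds no further
-- force is possible, since each productive round colours a new vertex.
closure : ∀ {n} → Graph n → Subset n → Subset n
closure {n} G S = iterate n (forceStep G) S

isZeroForcing : ∀ {n} → Graph n → Subset n → Bool
isZeroForcing G S = allV (λ v → v ∈ᵇ closure G S)

allSubsets : (n : ℕ) → List (Subset n)
allSubsets zero    = [] ∷ []
allSubsets (suc n) = L.map (true ∷_) (allSubsets n) ++ L.map (false ∷_) (allSubsets n)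

numForts : ∀ {n} → Graph n → ℕ
numForts {n} G = length (filterᵇ (isFort G) (allSubsets n))

sizeOf : ∀ {n} → Subset n → ℕ
sizeOf S = countV (λ v → v ∈ᵇ S)

z : ∀ {n} → Graph n → ℕ → ℕ
z {n} G i = length (filterᵇ (λ S → isZeroForcing G S ∧ (sizeOf S ≡ᵇ i)) (allSubsets n))

sumFrom1 : ℕ → (ℕ → ℕ) → ℕ
sumFrom1 zero    f = 0
sumFrom1 (suc k) f = sumFrom1 k f + f (suc k)

Z1 : ∀ {n} → Graph n → ℕ
Z1 {n} G = sumFrom1 n (z G)

-- Colour can never enter a fort F from outside: if every coloured
-- vertex lies outside F and a coloured u forces some v ∈ F, then v is an
-- uncoloured neighbour of u in F; u ∉ F has ≠ 1 neighbours in F, hence at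
-- least two, all uncoloured — so u had two uncoloured neighbours and could
-- not force.  Consequently, if the complement ∁S of S is a fort, then S is
-- not a zero forcing set (the non-empty fort ∁S stays uncoloured).
--
-- Then
--   #forts = #{S : ∁S fort} ≤ #{S : S not zero forcing}
--          = 2^n − #{zero forcing sets} ≤ 2^n − 𝓩(G;1).
module Submission where

open import Defs hiding (sym)
open import Data.Nat using (ℕ; zero; suc; _+_; _∸_; _^_; _≤_; _<_; _≡ᵇ_; z≤n; s≤s)
open import Data.Nat.Properties
  using ( +-identityʳ; +-suc; +-comm; +-commutativeSemigroup; +-mono-≤; ≡ᵇ⇒≡; m+n∸m≡n
        ; ≤-reflexive; ≤-trans; ≤-antisym; m≤n⇒m≤1+n; <-irrefl; <-trans; n<1+n
        ; ∸-monoʳ-≤; module ≤-Reasoning )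
open import Algebra.Properties.CommutativeSemigroup +-commutativeSemigroup
  using () renaming (interchange to +-interchange)
open import Data.Bool using (Bool; true; false; _∧_; _∨_; not; if_then_else_)
open import Data.Bool.Properties using (T-≡; not-involutive)
open import Data.Fin using (Fin)
open import Data.Fin.Subset using (Subset; ∁)
open import Data.Vec using ([]; _∷_; lookup)
open import Data.Vec.Properties using (lookup-map; lookup∘tabulate)
open import Data.List using (List; []; _∷_; _++_; length; filterᵇ; allFin)
import Data.List as List
open import Data.List.Properties using (length-map; length-++)
open import Data.List.Membership.Propositional using (_∈_)
open import Data.List.Membership.Propositional.Properties using (∈-allFin)
open import Data.List.Relation.Unary.Any using (here; there)
open import Data.Product using (Σ; _,_; _×_; proj₁; proj₂)
open import Data.Empty using (⊥-elim)
open import Function using (_∘_; Equivalence)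
open import Relation.Binary.PropositionalEquality

true≢false : true ≢ false
true≢false ()

count : ∀ {A : Set} → (A → Bool) → List A → ℕ
count p xs = length (filterᵇ p xs)

indicator : Bool → ℕ
indicator b = if b then 1 else 0

count-∷ : ∀ {A : Set} (p : A → Bool) x xs →
          count p (x ∷ xs) ≡ indicator (p x) + count p xs
count-∷ p x xs with p x
... | true  = refl
... | false = refl

count-++ : ∀ {A : Set} (p : A → Bool) xs ys →
           count p (xs ++ ys) ≡ count p xs + count p ys
count-++ p []       ys = refl
count-++ p (x ∷ xs) ys with p x
... | true  = cong suc (count-++ p xs ys)
... | false = count-++ p xs ys

count-map : ∀ {A B : Set} (p : B → Bool) (f : A → B) xs →
            count p (List.map f xs) ≡ count (p ∘ f) xs
count-map p f []       = refl
count-map p f (x ∷ xs) with p (f x)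
... | true  = cong suc (count-map p f xs)
... | false = count-map p f xs

count-mono : ∀ {A : Set} (p q : A → Bool) → (∀ x → p x ≡ true → q x ≡ true) →
             ∀ xs → count p xs ≤ count q xs
count-mono p q p⇒q []       = z≤n
count-mono p q p⇒q (x ∷ xs) with p x in px | q x in qx
... | true  | true  = s≤s (count-mono p q p⇒q xs)
... | true  | false = ⊥-elim (true≢false (trans (sym (p⇒q x px)) qx))
... | false | true  = m≤n⇒m≤1+n (count-mono p q p⇒q xs)
... | false | false = count-mono p q p⇒q xs

count-witness : ∀ {A : Set} (p : A → Bool) {v} xs → p v ≡ true → v ∈ xs →
                1 ≤ count p xs
count-witness p (x ∷ xs) pv (here refl) rewrite pv = s≤s z≤n
count-witness p (x ∷ xs) pv (there v∈xs) with p x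
... | true  = s≤s z≤n
... | false = count-witness p xs pv v∈xs

count-complement : ∀ {A : Set} (p : A → Bool) xs →
                   count p xs + count (not ∘ p) xs ≡ length xs
count-complement p []       = refl
count-complement p (x ∷ xs) with p x
... | true  = cong suc (count-complement p xs)
... | false = trans (+-suc _ _) (cong suc (count-complement p xs))

count-not : ∀ {A : Set} (p : A → Bool) xs →
            count (not ∘ p) xs ≡ length xs ∸ count p xs
count-not p xs = begin
    count (not ∘ p) xs
  ≡⟨ sym (m+n∸m≡n (count p xs) _) ⟩
    count p xs + count (not ∘ p) xs ∸ count p xs
  ≡⟨ cong (_∸ count p xs) (count-complement p xs) ⟩
    length xs ∸ count p xs ∎
  where open ≡-Reasoning

length-allSubsets : ∀ n → length (allSubsets n) ≡ 2 ^ n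
length-allSubsets zero    = refl
length-allSubsets (suc n) = begin
    length (List.map (true ∷_) A ++ List.map (false ∷_) A)
  ≡⟨ length-++ (List.map (true ∷_) A) ⟩
    length (List.map (true ∷_) A) + length (List.map (false ∷_) A)
  ≡⟨ cong₂ _+_ (length-map _ A) (length-map _ A) ⟩
    length A + length A
  ≡⟨ cong₂ _+_ (length-allSubsets n) (trans (length-allSubsets n) (sym (+-identityʳ _))) ⟩
    2 ^ suc n ∎
  where
    open ≡-Reasoning
    A : List (Subset n)
    A = allSubsets n

-- By induction: complementing swaps
-- the two halves (first bit true / first bit false) of allSubsets (suc n).
count-∁ : ∀ n (p : Subset n → Bool) →
          count p (allSubsets n) ≡ count (p ∘ ∁) (allSubsets n)
count-∁ zero    p = trans (count-∷ p [] []) (sym (count-∷ (p ∘ ∁) [] []))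
count-∁ (suc n) p = begin
    count p (List.map (true ∷_) A ++ List.map (false ∷_) A)
  ≡⟨ halves p ⟩
    count (p ∘ (true ∷_)) A + count (p ∘ (false ∷_)) A
  ≡⟨ cong₂ _+_ (count-∁ n (p ∘ (true ∷_))) (count-∁ n (p ∘ (false ∷_))) ⟩
    count (p ∘ (true ∷_) ∘ ∁) A + count (p ∘ (false ∷_) ∘ ∁) A
  ≡⟨ +-comm (count (p ∘ (true ∷_) ∘ ∁) A) _ ⟩
    count (p ∘ ∁ ∘ (true ∷_)) A + count (p ∘ ∁ ∘ (false ∷_)) A
  ≡⟨ sym (halves (p ∘ ∁)) ⟩
    count (p ∘ ∁) (List.map (true ∷_) A ++ List.map (false ∷_) A) ∎
  where
    open ≡-Reasoning
    A : List (Subset n)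
    A = allSubsets n
    halves : (q : Subset (suc n) → Bool) →
             count q (List.map (true ∷_) A ++ List.map (false ∷_) A)
               ≡ count (q ∘ (true ∷_)) A + count (q ∘ (false ∷_)) A
    halves q = trans (count-++ q (List.map (true ∷_) A) _)
                     (cong₂ _+_ (count-map q _ A) (count-map q _ A))

sumFrom1-cong : ∀ k (f g : ℕ → ℕ) → (∀ i → f i ≡ g i) →
                sumFrom1 k f ≡ sumFrom1 k g
sumFrom1-cong zero    f g f≗g = refl
sumFrom1-cong (suc k) f g f≗g = cong₂ _+_ (sumFrom1-cong k f g f≗g) (f≗g (suc k))

sumFrom1-zero : ∀ k → sumFrom1 k (λ _ → 0) ≡ 0
sumFrom1-zero zero    = refl
sumFrom1-zero (suc k) = trans (+-identityʳ _) (sumFrom1-zero k)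

sumFrom1-+ : ∀ k (f g : ℕ → ℕ) →
             sumFrom1 k (λ i → f i + g i) ≡ sumFrom1 k f + sumFrom1 k g
sumFrom1-+ zero    f g = refl
sumFrom1-+ (suc k) f g = begin
    sumFrom1 k (λ i → f i + g i) + (f (suc k) + g (suc k))
  ≡⟨ cong (_+ (f (suc k) + g (suc k))) (sumFrom1-+ k f g) ⟩
    (sumFrom1 k f + sumFrom1 k g) + (f (suc k) + g (suc k))
  ≡⟨ +-interchange (sumFrom1 k f) (sumFrom1 k g) (f (suc k)) (g (suc k)) ⟩
    (sumFrom1 k f + f (suc k)) + (sumFrom1 k g + g (suc k)) ∎
  where open ≡-Reasoning

≡ᵇ-sound : ∀ {m n} → (m ≡ᵇ n) ≡ true → m ≡ n
≡ᵇ-sound {m} {n} eq = ≡ᵇ⇒≡ m n (Equivalence.from T-≡ eq)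

sumFrom1-indicator-below : ∀ m k → k < m →
                           sumFrom1 k (λ i → indicator (m ≡ᵇ i)) ≡ 0
sumFrom1-indicator-below m zero    _   = refl
sumFrom1-indicator-below m (suc k) k<m with m ≡ᵇ suc k in eq
... | true  = ⊥-elim (<-irrefl (sym (≡ᵇ-sound eq)) k<m)
... | false = trans (+-identityʳ _)
                    (sumFrom1-indicator-below m k (<-trans (n<1+n k) k<m))

sumFrom1-indicator≤1 : ∀ m k → sumFrom1 k (λ i → indicator (m ≡ᵇ i)) ≤ 1
sumFrom1-indicator≤1 m zero    = z≤n
sumFrom1-indicator≤1 m (suc k) with m ≡ᵇ suc k in eq
... | true  = ≤-reflexive (cong (_+ 1) (sumFrom1-indicator-below m k k<m))
  where
    k<m : k < m
    k<m = subst (k <_) (sym (≡ᵇ-sound eq)) (n<1+n k)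
... | false = ≤-trans (≤-reflexive (+-identityʳ _)) (sumFrom1-indicator≤1 m k)

count-by-size : ∀ {A : Set} (q : A → Bool) (s : A → ℕ) k xs →
                sumFrom1 k (λ i → count (λ x → q x ∧ (s x ≡ᵇ i)) xs) ≤ count q xs
count-by-size     q s k []       = ≤-reflexive (sumFrom1-zero k)
count-by-size {A} q s k (x ∷ xs) = begin
    sumFrom1 k (λ i → count (qₛ i) (x ∷ xs))
  ≡⟨ sumFrom1-cong k _ _ (λ i → count-∷ (qₛ i) x xs) ⟩
    sumFrom1 k (λ i → indicator (qₛ i x) + count (qₛ i) xs)
  ≡⟨ sumFrom1-+ k _ _ ⟩
    sumFrom1 k (λ i → indicator (qₛ i x)) + sumFrom1 k (λ i → count (qₛ i) xs)
  ≤⟨ +-mono-≤ (head (q x)) (count-by-size q s k xs) ⟩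
    indicator (q x) + count q xs
  ≡⟨ sym (count-∷ q x xs) ⟩
    count q (x ∷ xs) ∎
  where
    open ≤-Reasoning
    qₛ : ℕ → A → Bool
    qₛ i y = q y ∧ (s y ≡ᵇ i)
    -- x contributes to at most one size class, and only if q x holds
    head : ∀ b → sumFrom1 k (λ i → indicator (b ∧ (s x ≡ᵇ i))) ≤ indicator b
    head true  = sumFrom1-indicator≤1 (s x) k
    head false = ≤-reflexive (sumFrom1-zero k)

∧-elim : ∀ {a b} → a ∧ b ≡ true → (a ≡ true) × (b ≡ true)
∧-elim {true} {true} refl = refl , refl

∧₃-elim : ∀ {a b c} → a ∧ b ∧ c ≡ true → (a ≡ true) × (b ≡ true) × (c ≡ true)
∧₃-elim {true} {true} {true} refl = refl , refl , refl

∨-resolve : ∀ {a b} → a ∨ b ≡ true → a ≡ false → b ≡ true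
∨-resolve {false} b≡true refl = b≡true

all-elim : ∀ {A : Set} (p : A → Bool) xs →
           List.foldr (λ v b → p v ∧ b) true xs ≡ true → ∀ {v} → v ∈ xs → p v ≡ true
all-elim p (x ∷ xs) all (here refl)  = proj₁ (∧-elim all)
all-elim p (x ∷ xs) all (there v∈xs) = all-elim p xs (proj₂ (∧-elim all)) v∈xs

any-elim : ∀ {A : Set} (p : A → Bool) xs →
           List.foldr (λ v b → p v ∨ b) false xs ≡ true → Σ A (λ v → p v ≡ true)
any-elim p (x ∷ xs) any with p x in px
... | true  = x , px
... | false = any-elim p xs any

allV-elim : ∀ {n} (p : Fin n → Bool) → allV p ≡ true → ∀ v → p v ≡ true
allV-elim {n} p all v = all-elim p (allFin n) all (∈-allFin v)

anyV-elim : ∀ {n} (p : Fin n → Bool) → anyV p ≡ true → Σ (Fin n) (λ v → p v ≡ true)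
anyV-elim {n} p = any-elim p (allFin n)

-- The coloured set T avoids F.  (A record, so that T and F can be
-- inferred from the type.)
record Disjoint {n} (T F : Subset n) : Set where
  constructor disjoint
  field apart : ∀ v → lookup T v ≡ true → lookup F v ≡ false
open Disjoint

module _ {n} (G : Graph n) where

  nbrsIn≤uncolouredNbrs : ∀ {T F} → Disjoint T F → ∀ u →
                          nbrsIn G F u ≤ uncolouredNbrs G T u
  nbrsIn≤uncolouredNbrs {T} {F} T#F u = count-mono _ _ uncoloured (allFin n)
    where
      uncoloured : ∀ w → (adj G u w ∧ lookup F w) ≡ true → (adj G u w ∧ not (lookup T w)) ≡ true
      uncoloured w uw∧w∈F with ∧-elim {adj G u w} uw∧w∈F | lookup T w in w∈T
      ... | _  , w∈F | true  = ⊥-elim (true≢false (trans (sym w∈F) (apart T#F w w∈T)))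
      ... | uw , _   | false = cong (_∧ true) uw

  module _ (F : Subset n) (fort : isFort G F ≡ true) where

    fort-nonempty : Σ (Fin n) (λ v → lookup F v ≡ true)
    fort-nonempty = anyV-elim _ (proj₁ (∧-elim {anyV (λ v → lookup F v)} fort))

    fort-outside : ∀ u → lookup F u ≡ false → (nbrsIn G F u ≡ᵇ 1) ≡ false
    fort-outside u u∉F = trans (sym (not-involutive _)) (cong not (∨-resolve {lookup F u} holds u∉F))
      where
        holds : (lookup F u ∨ not (nbrsIn G F u ≡ᵇ 1)) ≡ true
        holds = allV-elim _ (proj₂ (∧-elim {anyV (λ v → lookup F v)} fort)) u

    -- A coloured vertex u adjacent to v ∈ F lies outside F, so it has a
    -- second neighbour in F; both are uncoloured, hence u cannot force.
    no-force-into-fort : ∀ {T} → Disjoint T F →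
                         ∀ u v → lookup T u ≡ true → adj G u v ≡ true → lookup F v ≡ true →
                         (uncolouredNbrs G T u ≡ᵇ 1) ≡ false
    no-force-into-fort {T} T#F u v u∈T uv v∈F with uncolouredNbrs G T u ≡ᵇ 1 in one
    ... | false = refl
    ... | true  = ⊥-elim (true≢false (trans (sym (cong (_≡ᵇ 1) exactly-one))
                                            (fort-outside u (apart T#F u u∈T))))
      where
        at-most-one : nbrsIn G F u ≤ 1
        at-most-one = ≤-trans (nbrsIn≤uncolouredNbrs T#F u) (≤-reflexive (≡ᵇ-sound one))
        at-least-one : 1 ≤ nbrsIn G F u
        at-least-one = count-witness _ (allFin n) (cong₂ _∧_ uv v∈F) (∈-allFin v)
        exactly-one : nbrsIn G F u ≡ 1
        exactly-one = ≤-antisym at-most-one at-least-one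

    -- One round of forcing keeps the coloured set disjoint from the fort:
    -- a newly coloured v ∈ F would have been forced by a coloured u.
    forceStep-avoids-fort : ∀ {T} → Disjoint T F → Disjoint (forceStep G T) F
    apart (forceStep-avoids-fort {T} T#F) v v∈T′ with lookup F v in v∈F | lookup T v in v∈T
    ... | false | _     = refl
    ... | true  | true  = ⊥-elim (true≢false (trans (sym v∈F) (apart T#F v v∈T)))
    ... | true  | false
      with anyV-elim _ (∨-resolve {lookup T v} (trans (sym (lookup∘tabulate _ v)) v∈T′) v∈T)
    ...   | u , u-forces-v with ∧₃-elim {lookup T u} {adj G u v} u-forces-v
    ...     | u∈T , uv , one =
      ⊥-elim (true≢false (trans (sym one) (no-force-into-fort T#F u v u∈T uv v∈F)))

    closure-avoids-fort : ∀ k T → Disjoint T F → Disjoint (iterate k (forceStep G) T) F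
    closure-avoids-fort zero    T T#F = T#F
    closure-avoids-fort (suc k) T T#F =
      closure-avoids-fort k (forceStep G T) (forceStep-avoids-fort T#F)

  -- If ∁S is a fort, the closure of S misses the (non-empty) fort ∁S.
  fort-complement-not-zero-forcing : ∀ S → isFort G (∁ S) ≡ true → isZeroForcing G S ≡ false
  fort-complement-not-zero-forcing S fort with isZeroForcing G S in zf
  ... | false = refl
  ... | true  with fort-nonempty (∁ S) fort
  ...   | v , v∈∁S = ⊥-elim (true≢false (trans (sym v∈∁S) v∉∁S))
    where
      S#∁S : Disjoint S (∁ S)
      apart S#∁S w w∈S = trans (lookup-map w not S) (cong not w∈S)
      v∉∁S : lookup (∁ S) v ≡ false
      v∉∁S = apart (closure-avoids-fort (∁ S) fort n S S#∁S) v (allV-elim _ zf v)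

proposition5p5 : (n : ℕ) (G : Graph n) → numForts G ≤ 2 ^ n ∸ Z1 G
proposition5p5 n G = begin
    numForts G
  ≡⟨ count-∁ n (isFort G) ⟩
    count (isFort G ∘ ∁) A
  ≤⟨ count-mono _ _ (λ S fort → cong not (fort-complement-not-zero-forcing G S fort)) A ⟩
    count (not ∘ isZeroForcing G) A
  ≡⟨ count-not (isZeroForcing G) A ⟩
    length A ∸ count (isZeroForcing G) A
  ≡⟨ cong (_∸ count (isZeroForcing G) A) (length-allSubsets n) ⟩
    2 ^ n ∸ count (isZeroForcing G) A
  ≤⟨ ∸-monoʳ-≤ (2 ^ n) (count-by-size (isZeroForcing G) sizeOf n A) ⟩
    2 ^ n ∸ Z1 G ∎
  where
    open ≤-Reasoning
    A : List (Subset n)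
    A = allSubsets n
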